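{- Let $n\ge 2$ and $G_n=C_{2^n}\times C_{2^n}$. Let $\chi_1,\chi_2\in G_n^*$ be characters lying in the same $U(G_n^*)$-equivalence class, i.e. $\chi_2=\chi_1^m$ for some odd integer $m$. Then for every node $M$ of the orbit tree $T_n$ we have $\chi_1(M)=\chi_2(M)$, where for a node $M$ (a subset of $G_n$) and a character $\chi$ we write $\chi(M)=\sum_{g\in M}\chi(g)$.
   Context: $C_m=\{x/m: x\in\{0,\dots,m-1\}\}$ under addition mod $1$, and $G_n=C_{2^n}\times C_{2^n}$, with dual group $G_n^*$ of complex characters. The multiplier group $U(2^n)=\{u: u \text{ odd}, 1\le u\le 2^n\}$ acts on $G_n$ by $g\mapsto u\cdot g$. The orbit tree $T_n$ is the rooted tree whose nodes are the orbits of $G_n$ under this action: the root is $\{(0,0)\}$, the nodes at level $i$ are the orbits consisting of elements of order $2^i$ ($0\le i\le n$), and the parent of a node $M$ at level $i+1$ is the orbit containing $2x$ for any $x\in M$. -}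

module Defs where

open import Data.Nat using (ℕ; zero; suc; _+_; _*_; _∸_; _^_; _<ᵇ_; _≡ᵇ_; NonZero)
open import Data.Nat.Properties using (m^n≢0)
open import Data.Nat.DivMod using (_%_)
open import Data.Integer as ℤ using (ℤ; +_; -_)
open import Data.Integer.DivMod using (_%ℕ_)
open import Data.Fin using (Fin; toℕ)
open import Data.Bool using (Bool; true; false; if_then_else_; _∧_)
open import Data.Bool.ListAction using (any)
open import Data.List using (List; map; foldr; upTo; allFin; cartesianProduct)
open import Data.Product using (_×_; _,_; proj₁; proj₂)

ord : ℕ → ℕ
ord n = 2 ^ n

_mod2^_ : ℕ → ℕ → ℕ
e mod2^ n = _%_ e (ord n) {{m^n≢0 2 n}}

_zmod2^_ : ℤ → ℕ → ℕ
m zmod2^ n = _%ℕ_ m (ord n) {{m^n≢0 2 n}}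

-- G_n = C_{2^n} × C_{2^n}; the element (x,y) stands for (x/2^n, y/2^n).
G : ℕ → Set
G n = Fin (ord n) × Fin (ord n)

elements : (n : ℕ) → List (G n)
elements n = cartesianProduct (allFin (ord n)) (allFin (ord n))

-- The ring Z[ζ], ζ = exp(2πi/2^n), n ≥ 1, represented exactly via
-- Z[ζ] ≅ Z[x]/(x^(2^(n-1)) + 1): an element is its coefficient vector
-- w.r.t. the Z-basis 1, ζ, …, ζ^(2^(n-1) - 1).
Cyc : ℕ → Set
Cyc n = Fin (2 ^ (n ∸ 1)) → ℤ

czero : (n : ℕ) → Cyc n
czero n _ = + 0

cadd : (n : ℕ) → Cyc n → Cyc n → Cyc n
cadd n f g i = f i ℤ.+ g i

-- ζ^e  (using ζ^(2^(n-1)) = -1)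
zpow : (n : ℕ) → ℕ → Cyc n
zpow n e i =
  let h = 2 ^ (n ∸ 1)
      r = e mod2^ n
  in if r <ᵇ h
     then (if toℕ i ≡ᵇ r then + 1 else + 0)
     else (if toℕ i ≡ᵇ (r ∸ h) then - (+ 1) else + 0)

-- Characters of G_n: the character χ_(a,b) is (x,y) ↦ ζ^(a x + b y);
-- every element of G_n^* is χ_(a,b) for a unique (a,b) ∈ G_n.
char : (n : ℕ) → G n → G n → Cyc n
char n (a , b) (x , y) = zpow n (toℕ a * toℕ x + toℕ b * toℕ y)

-- χ_2 = χ_1^m  (for an integer m), in terms of the labels:
-- χ_(a,b)^m = χ_(m a mod 2^n, m b mod 2^n).
IsPower : (n : ℕ) → G n → G n → ℤ → Set
IsPower n (a , b) (c , d) m =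
  (toℕ c ≡ ((m ℤ.* + toℕ a) zmod2^ n)) × (toℕ d ≡ ((m ℤ.* + toℕ b) zmod2^ n))
  where open import Relation.Binary.PropositionalEquality using (_≡_)

OddInt : ℤ → Set
OddInt m = ℤ.∣ m ∣ % 2 ≡ 1
  where open import Relation.Binary.PropositionalEquality using (_≡_)

act : (n : ℕ) → ℕ → G n → ℕ × ℕ
act n u (x , y) = ((u * toℕ x) mod2^ n , (u * toℕ y) mod2^ n)

-- h lies in the U(2^n)-orbit of g: h = u·g for some odd u, 1 ≤ u ≤ 2^n
-- (u = 2^n is never odd for n ≥ 1, so we range over 0 ≤ u < 2^n).
inOrbit : (n : ℕ) → G n → G n → Bool
inOrbit n g (x , y) =
  any (λ u → ((u % 2) ≡ᵇ 1) ∧ (proj₁ (act n u g) ≡ᵇ toℕ x) ∧ (proj₂ (act n u g) ≡ᵇ toℕ y))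
      (upTo (ord n))

-- The nodes of T_n are exactly the U(2^n)-orbits of G_n; Node n g is the
-- orbit of g, viewed as a decidable subset of G_n.
Node : (n : ℕ) → G n → G n → Bool
Node = inOrbit

charSum : (n : ℕ) → (G n → Cyc n) → (G n → Bool) → Cyc n
charSum n χ M = foldr (λ h acc → cadd n (if M h then χ h else czero n) acc) (czero n) (elements n)

module Submission where

-- Multiplication by an odd u permutes G_n coordinatewise and maps every U(2^n)-orbit onto
-- itself, while χ_(a,b)(u·h) = χ_(u·(a,b))(h) because characters come from the symmetric
-- pairing (a,b)·(x,y) = a x + b y. Reindexing the orbit sum by h ↦ u·h thus gives
-- χ(M) = (u·χ)(M), and χ^m = u·χ for u = m mod 2^n, which is odd when m is. The inverse of
-- u modulo 2^n is a power of u, since u^(2^k) ≡ 1 mod 2^(k+1).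

open import Defs
open import Data.Bool using (T; _∧_; true; false; if_then_else_)
open import Data.Bool.Properties using (T-∧; T-≡; ⇔→≡)
open import Data.Fin using (Fin; zero; suc; toℕ; fromℕ<)
open import Data.Fin.Permutation using (Permutation′; permutation; _⟨$⟩ʳ_)
open import Data.Fin.Properties using (toℕ-fromℕ<; toℕ-injective; toℕ<n)
open import Data.Integer as ℤ using (ℤ; +_; -[1+_]; -_; _-_; _⊖_; ∣_∣; _%ℕ_; _/ℕ_)
open import Data.Integer.DivMod using (a≡a%ℕn+[a/ℕn]*n; n%ℕd<d)
open import Data.Integer.Divisibility.Signed
  using (_∣_; divides; ∣⇒∣ᵤ; ∣ᵤ⇒∣; ∣-trans; ∣m⇒∣-m; ∣m∣n⇒∣m+n; ∣m⇒∣m*n)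
import Data.Integer.Properties as ℤ
open import Data.Integer.Tactic.RingSolver using (solve-∀)
open import Data.List using (List; []; _∷_; _++_; map; foldr; tabulate; allFin; cartesianProduct)
open import Data.List.Relation.Unary.Any.Properties using (any⁺; any⁻; applyUpTo⁺; applyUpTo⁻)
open import Data.Nat as ℕ using (ℕ; zero; suc; s≤s; _+_; _*_; _∸_; _^_; _≤_; _<_; _≡ᵇ_; NonZero)
open import Data.Nat.DivMod
  using (_%_; _/_; m≡m%n+[m/n]*n; m%n<n; m<n⇒m%n≡m; m%n%n≡m%n; [m+kn]%n≡m%n; %-distribˡ-+; %-distribˡ-*;
         %-remove-+ˡ; m∣n⇒o%n%m≡o%m)
import Data.Nat.Divisibility as ℕ
import Data.Nat.Properties as ℕ
import Data.Nat.Tactic.RingSolver as ℕ-Ring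
open import Data.Product using (Σ; ∃-syntax; _×_; _,_)
open import Data.Sum using (inj₁; inj₂)
open import Function using (_$_; id; _∘_)
open import Function.Bundles using (Equivalence; mk⇔)
open import Relation.Binary.PropositionalEquality
open import Algebra.Properties.CommutativeMonoid.Sum ℤ.+-0-commutativeMonoid
  using (sum; sum-syntax; sum-cong-≗; sum-permute)

infix 4 _≡_mod_

record _≡_mod_ (i j : ℤ) (d : ℕ) : Set where
  constructor congruent
  field modulus∣difference : + d ∣ i - j

≡-mod-sym : ∀ {i j d} → i ≡ j mod d → j ≡ i mod d
≡-mod-sym {i} {j} (congruent d∣i-j) = congruent (subst (_ ∣_) (-[i-j]≡j-i i j) (∣m⇒∣-m d∣i-j))
  where
  -[i-j]≡j-i : ∀ i j → - (i - j) ≡ j - i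
  -[i-j]≡j-i = solve-∀

≡-mod-trans : ∀ {i j k d} → i ≡ j mod d → j ≡ k mod d → i ≡ k mod d
≡-mod-trans {i} {j} {k} (congruent d∣i-j) (congruent d∣j-k) =
  congruent (subst (_ ∣_) (ℤ.+-minus-telescope i j k) (∣m∣n⇒∣m+n d∣i-j d∣j-k))

≡-mod-*ʳ : ∀ {i j d} c → i ≡ j mod d → i ℤ.* c ≡ j ℤ.* c mod d
≡-mod-*ʳ {i} {j} c (congruent d∣i-j) = congruent (subst (_ ∣_) ([i-j]*c≡i*c-j*c i j c) (∣m⇒∣m*n c d∣i-j))
  where
  [i-j]*c≡i*c-j*c : ∀ i j c → (i - j) ℤ.* c ≡ i ℤ.* c - j ℤ.* c
  [i-j]*c≡i*c-j*c = solve-∀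

≡-mod-weaken : ∀ {i j d e} → d ℕ.∣ e → i ≡ j mod e → i ≡ j mod d
≡-mod-weaken d∣e (congruent e∣i-j) = congruent (∣-trans (∣ᵤ⇒∣ d∣e) e∣i-j)

≡-mod-%ℕ : ∀ i d .{{_ : NonZero d}} → i ≡ + (i %ℕ d) mod d
≡-mod-%ℕ i d = congruent $ divides (i /ℕ d) $
  trans (cong (_- + (i %ℕ d)) (a≡a%ℕn+[a/ℕn]*n i d)) ([r+q]-r≡q (+ (i %ℕ d)) _)
  where
  [r+q]-r≡q : ∀ r q → r ℤ.+ q - r ≡ q
  [r+q]-r≡q = solve-∀

∣m∣≡m-mod-2 : ∀ m → + ∣ m ∣ ≡ m mod 2
∣m∣≡m-mod-2 (+ a)    = congruent $ divides (+ 0) (ℤ.+-inverseʳ (+ a))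
∣m∣≡m-mod-2 -[1+ a ] = congruent $ divides (- -[1+ a ]) (-i-i≡-i*2 -[1+ a ])
  where
  -i-i≡-i*2 : ∀ i → - i - i ≡ (- i) ℤ.* + 2
  -i-i≡-i*2 = solve-∀

d∣m∸n⇒m%d≡n%d : ∀ {m n d} .{{_ : NonZero d}} → n ≤ m → d ℕ.∣ m ∸ n → m % d ≡ n % d
d∣m∸n⇒m%d≡n%d {m} {n} {d} n≤m d∣m∸n =
  trans (cong (_% d) (sym (ℕ.m∸n+n≡m n≤m))) (%-remove-+ˡ n d∣m∸n)

d∣∣m⊖n∣⇒m%d≡n%d : ∀ m n {d} .{{_ : NonZero d}} → d ℕ.∣ ∣ m ⊖ n ∣ → m % d ≡ n % d
d∣∣m⊖n∣⇒m%d≡n%d m n {d} d∣∣m⊖n∣ with ℕ.≤-total n m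
... | inj₁ n≤m =
  d∣m∸n⇒m%d≡n%d n≤m (subst (d ℕ.∣_) (trans (ℤ.∣m⊖n∣≡∣n⊖m∣ m n) (ℤ.∣⊖∣-≤ n≤m)) d∣∣m⊖n∣)
... | inj₂ m≤n =
  sym (d∣m∸n⇒m%d≡n%d m≤n (subst (d ℕ.∣_) (ℤ.∣⊖∣-≤ m≤n) d∣∣m⊖n∣))

+≡+-mod⇒%≡% : ∀ {m n d} .{{_ : NonZero d}} → + m ≡ + n mod d → m % d ≡ n % d
+≡+-mod⇒%≡% {m} {n} {d} (congruent d∣m-n) =
  d∣∣m⊖n∣⇒m%d≡n%d m n (subst (d ℕ.∣_) (cong ∣_∣ (ℤ.m-n≡m⊖n m n)) (∣⇒∣ᵤ d∣m-n))

%ℕ-cong : ∀ {i j d} .{{_ : NonZero d}} → i ≡ j mod d → i %ℕ d ≡ j %ℕ d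
%ℕ-cong {i} {j} {d} i≡j = begin
  i %ℕ d     ≡⟨ m<n⇒m%n≡m (n%ℕd<d i d) ⟨
  i %ℕ d % d ≡⟨ +≡+-mod⇒%≡% (≡-mod-trans (≡-mod-sym (≡-mod-%ℕ i d)) (≡-mod-trans i≡j (≡-mod-%ℕ j d))) ⟩
  j %ℕ d % d ≡⟨ m<n⇒m%n≡m (n%ℕd<d j d) ⟩
  j %ℕ d     ∎
  where open ≡-Reasoning

[i*a]%ℕd≡[i%ℕd*a]%d : ∀ i a d .{{_ : NonZero d}} → (i ℤ.* + a) %ℕ d ≡ (i %ℕ d * a) % d
[i*a]%ℕd≡[i%ℕd*a]%d i a d =
  trans (%ℕ-cong (≡-mod-*ʳ (+ a) (≡-mod-%ℕ i d))) (cong (_%ℕ d) (sym (ℤ.pos-* (i %ℕ d) a)))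

%ℕ-odd : ∀ {d} .{{_ : NonZero d}} → 2 ℕ.∣ d → ∀ i → ∣ i ∣ % 2 ≡ 1 → i %ℕ d % 2 ≡ 1
%ℕ-odd {d} 2∣d i i-odd =
  trans (sym (+≡+-mod⇒%≡% (≡-mod-trans (∣m∣≡m-mod-2 i) (≡-mod-weaken 2∣d (≡-mod-%ℕ i d))))) i-odd

%-absorbˡ-* : ∀ m n d .{{_ : NonZero d}} → (m % d * n) % d ≡ (m * n) % d
%-absorbˡ-* m n d = begin
  (m % d * n) % d           ≡⟨ %-distribˡ-* (m % d) n d ⟩
  (m % d % d * (n % d)) % d ≡⟨ cong (λ r → (r * (n % d)) % d) (m%n%n≡m%n m d) ⟩
  (m % d * (n % d)) % d     ≡⟨ %-distribˡ-* m n d ⟨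
  (m * n) % d               ∎
  where open ≡-Reasoning

%-absorbʳ-* : ∀ m n d .{{_ : NonZero d}} → (m * (n % d)) % d ≡ (m * n) % d
%-absorbʳ-* m n d = begin
  (m * (n % d)) % d ≡⟨ cong (_% d) (ℕ.*-comm m (n % d)) ⟩
  (n % d * m) % d   ≡⟨ %-absorbˡ-* n m d ⟩
  (n * m) % d       ≡⟨ cong (_% d) (ℕ.*-comm n m) ⟩
  (m * n) % d       ∎
  where open ≡-Reasoning

[a*[u*x%d]+b*[u*y%d]]%d≡[u*[a*x+b*y]]%d : ∀ a b u x y d .{{_ : NonZero d}} →
  (a * (u * x % d) + b * (u * y % d)) % d ≡ u * (a * x + b * y) % d
[a*[u*x%d]+b*[u*y%d]]%d≡[u*[a*x+b*y]]%d a b u x y d = begin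
  (a * (u * x % d) + b * (u * y % d)) % d         ≡⟨ %-distribˡ-+ (a * (u * x % d)) _ d ⟩
  (a * (u * x % d) % d + b * (u * y % d) % d) % d ≡⟨ cong₂ (λ p q → (p + q) % d)
                                                       (%-absorbʳ-* a (u * x) d) (%-absorbʳ-* b (u * y) d) ⟩
  (a * (u * x) % d + b * (u * y) % d) % d         ≡⟨ %-distribˡ-+ (a * (u * x)) _ d ⟨
  (a * (u * x) + b * (u * y)) % d                 ≡⟨ cong (_% d) (distribute a b u x y) ⟩
  u * (a * x + b * y) % d                         ∎
  where
  open ≡-Reasoning
  distribute : ∀ a b u x y → a * (u * x) + b * (u * y) ≡ u * (a * x + b * y)
  distribute = ℕ-Ring.solve-∀

*-odd : ∀ {m n} → m % 2 ≡ 1 → n % 2 ≡ 1 → m * n % 2 ≡ 1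
*-odd {m} {n} m-odd n-odd = trans (%-distribˡ-* m n 2) (cong₂ (λ r s → (r * s) % 2) m-odd n-odd)

^-odd : ∀ {m} → m % 2 ≡ 1 → ∀ k → m ^ k % 2 ≡ 1
^-odd     m-odd zero    = refl
^-odd {m} m-odd (suc k) = *-odd {m} {m ^ k} m-odd (^-odd m-odd k)

2∣2^n : ∀ n .{{_ : NonZero n}} → 2 ℕ.∣ 2 ^ n
2∣2^n (suc n) = ℕ.divides (2 ^ n) (ℕ.*-comm 2 (2 ^ n))

odd⇒^[2^k]≡1+t*2^[1+k] : ∀ {u} → u % 2 ≡ 1 → ∀ k → ∃[ t ] u ^ 2 ^ k ≡ 1 + t * 2 ^ suc k
odd⇒^[2^k]≡1+t*2^[1+k] {u} u-odd zero = u / 2 , (begin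
  u ^ 1             ≡⟨ ℕ.*-identityʳ u ⟩
  u                 ≡⟨ m≡m%n+[m/n]*n u 2 ⟩
  u % 2 + u / 2 * 2 ≡⟨ cong₂ _+_ u-odd (cong (u / 2 *_) (sym (ℕ.*-identityʳ 2))) ⟩
  1 + u / 2 * 2 ^ 1 ∎)
  where open ≡-Reasoning
odd⇒^[2^k]≡1+t*2^[1+k] {u} u-odd (suc k) with odd⇒^[2^k]≡1+t*2^[1+k] u-odd k
... | t , u^2^k≡1+t*2^[1+k] = t + t * t * 2 ^ k , (begin
  u ^ (2 * 2 ^ k)           ≡⟨ cong (u ^_) (ℕ.*-comm 2 (2 ^ k)) ⟩
  u ^ (2 ^ k * 2)           ≡⟨ ℕ.^-*-assoc u (2 ^ k) 2 ⟨
  (u ^ 2 ^ k) ^ 2           ≡⟨ cong (_^ 2) u^2^k≡1+t*2^[1+k] ⟩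
  (1 + t * (2 * 2 ^ k)) ^ 2 ≡⟨ square t (2 ^ k) ⟩
  1 + (t + t * t * 2 ^ k) * (2 * (2 * 2 ^ k)) ∎)
  where
  open ≡-Reasoning
  square : ∀ t p → (1 + t * (2 * p)) * ((1 + t * (2 * p)) * 1) ≡ 1 + (t + t * t * p) * (2 * (2 * p))
  square = ℕ-Ring.solve-∀

module _ {N : ℕ} .{{_ : NonZero N}} where

  scale : ℕ → Fin N → Fin N
  scale w x = fromℕ< (m%n<n (w * toℕ x) N)

  toℕ-scale : ∀ w x → toℕ (scale w x) ≡ w * toℕ x % N
  toℕ-scale w x = toℕ-fromℕ< (m%n<n (w * toℕ x) N)

  scale-cong : ∀ {w w'} → w % N ≡ w' % N → ∀ x → scale w x ≡ scale w' x
  scale-cong {w} {w'} w≡w' x = toℕ-injective (begin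
    toℕ (scale w x)    ≡⟨ toℕ-scale w x ⟩
    w * toℕ x % N      ≡⟨ %-absorbˡ-* w (toℕ x) N ⟨
    w % N * toℕ x % N  ≡⟨ cong (λ r → r * toℕ x % N) w≡w' ⟩
    w' % N * toℕ x % N ≡⟨ %-absorbˡ-* w' (toℕ x) N ⟩
    w' * toℕ x % N     ≡⟨ toℕ-scale w' x ⟨
    toℕ (scale w' x)   ∎)
    where open ≡-Reasoning

  scale-* : ∀ w w' x → scale (w' * w) x ≡ scale w' (scale w x)
  scale-* w w' x = toℕ-injective (begin
    toℕ (scale (w' * w) x)     ≡⟨ toℕ-scale (w' * w) x ⟩
    w' * w * toℕ x % N         ≡⟨ cong (_% N) (ℕ.*-assoc w' w (toℕ x)) ⟩
    w' * (w * toℕ x) % N       ≡⟨ %-absorbʳ-* w' (w * toℕ x) N ⟨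
    w' * (w * toℕ x % N) % N   ≡⟨ cong (λ r → w' * r % N) (toℕ-scale w x) ⟨
    w' * toℕ (scale w x) % N   ≡⟨ toℕ-scale w' (scale w x) ⟨
    toℕ (scale w' (scale w x)) ∎)
    where open ≡-Reasoning

  scale-1 : ∀ x → scale 1 x ≡ x
  scale-1 x = toℕ-injective (trans (toℕ-scale 1 x)
    (trans (cong (_% N) (ℕ.*-identityˡ (toℕ x))) (m<n⇒m%n≡m (toℕ<n x))))

  scale-inverse : ∀ u v → v * u % N ≡ 1 % N → ∀ x → scale v (scale u x) ≡ x
  scale-inverse u v vu≡1 x = trans (sym (scale-* u v x)) (trans (scale-cong vu≡1 x) (scale-1 x))

  scale-permutation : ∀ u v → v * u % N ≡ 1 % N → Permutation′ N
  scale-permutation u v vu≡1 =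
    permutation (scale u) (scale v) (scale-inverse v u uv≡1) (scale-inverse u v vu≡1)
    where
    uv≡1 : u * v % N ≡ 1 % N
    uv≡1 = trans (cong (_% N) (ℕ.*-comm u v)) vu≡1

  infixr 7 _·_

  _·_ : ℕ → Fin N × Fin N → Fin N × Fin N
  w · (x , y) = scale w x , scale w y

  ·-cong : ∀ {w w'} → w % N ≡ w' % N → ∀ g → w · g ≡ w' · g
  ·-cong w≡w' (x , y) = cong₂ _,_ (scale-cong w≡w' x) (scale-cong w≡w' y)

  ·-* : ∀ w w' g → (w' * w) · g ≡ w' · w · g
  ·-* w w' (x , y) = cong₂ _,_ (scale-* w w' x) (scale-* w w' y)

  ·-inverse : ∀ u v → v * u % N ≡ 1 % N → ∀ g → v · u · g ≡ g
  ·-inverse u v vu≡1 (x , y) = cong₂ _,_ (scale-inverse u v vu≡1 x) (scale-inverse u v vu≡1 y)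

∑ᴸ : ∀ {A : Set} → (A → ℤ) → List A → ℤ
∑ᴸ f = foldr (λ a s → f a ℤ.+ s) (+ 0)

∑ᴸ-++ : ∀ {A : Set} (f : A → ℤ) xs ys → ∑ᴸ f (xs ++ ys) ≡ ∑ᴸ f xs ℤ.+ ∑ᴸ f ys
∑ᴸ-++ f []       ys = sym (ℤ.+-identityˡ (∑ᴸ f ys))
∑ᴸ-++ f (x ∷ xs) ys = trans (cong (ℤ._+_ (f x)) (∑ᴸ-++ f xs ys)) (sym (ℤ.+-assoc (f x) _ _))

∑ᴸ-map : ∀ {A B : Set} (f : B → ℤ) (h : A → B) xs → ∑ᴸ f (map h xs) ≡ ∑ᴸ (f ∘ h) xs
∑ᴸ-map f h []       = refl
∑ᴸ-map f h (x ∷ xs) = cong (ℤ._+_ (f (h x))) (∑ᴸ-map f h xs)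

∑ᴸ-cartesianProduct : ∀ {A B : Set} (f : A × B → ℤ) xs ys →
                      ∑ᴸ f (cartesianProduct xs ys) ≡ ∑ᴸ (λ x → ∑ᴸ (λ y → f (x , y)) ys) xs
∑ᴸ-cartesianProduct f []       ys = refl
∑ᴸ-cartesianProduct f (x ∷ xs) ys = trans (∑ᴸ-++ f (map (x ,_) ys) _)
  (cong₂ ℤ._+_ (∑ᴸ-map f (x ,_) ys) (∑ᴸ-cartesianProduct f xs ys))

∑ᴸ-tabulate : ∀ {A : Set} {k} (f : A → ℤ) (g : Fin k → A) → ∑ᴸ f (tabulate g) ≡ sum (f ∘ g)
∑ᴸ-tabulate {k = zero}  f g = refl
∑ᴸ-tabulate {k = suc k} f g = cong (ℤ._+_ (f (g zero))) (∑ᴸ-tabulate f (g ∘ suc))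

∑ᴸ-allFin² : ∀ {k} (f : Fin k × Fin k → ℤ) →
             ∑ᴸ f (cartesianProduct (allFin k) (allFin k)) ≡ ∑[ x < k ] ∑[ y < k ] f (x , y)
∑ᴸ-allFin² {k} f = trans (∑ᴸ-cartesianProduct f (allFin k) (allFin k)) $
  trans (∑ᴸ-tabulate (λ x → ∑ᴸ (λ y → f (x , y)) (allFin k)) id)
        (sum-cong-≗ (λ x → ∑ᴸ-tabulate (λ y → f (x , y)) id))

∑²-permute : ∀ {k} (f : Fin k × Fin k → ℤ) (π : Permutation′ k) →
             ∑[ x < k ] ∑[ y < k ] f (x , y) ≡ ∑[ x < k ] ∑[ y < k ] f (π ⟨$⟩ʳ x , π ⟨$⟩ʳ y)
∑²-permute f π = trans (sum-permute (λ x → ∑[ y < _ ] f (x , y)) π)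
  (sum-cong-≗ (λ x → sum-permute (λ y → f (π ⟨$⟩ʳ x , y)) π))

foldr-cadd : ∀ {A : Set} n (f : A → Cyc n) xs i →
             foldr (λ a acc → cadd n (f a) acc) (czero n) xs i ≡ ∑ᴸ (λ a → f a i) xs
foldr-cadd n f []       i = refl
foldr-cadd n f (x ∷ xs) i = cong (ℤ._+_ (f x i)) (foldr-cadd n f xs i)

T⇔T⇒≡ : ∀ {a b} → (T a → T b) → (T b → T a) → a ≡ b
T⇔T⇒≡ a→b b→a = ⇔→≡ {z = true} (mk⇔ (to T-≡ ∘ a→b ∘ from T-≡) (to T-≡ ∘ b→a ∘ from T-≡))
  where open Equivalence

module _ (n : ℕ) where

  private instance
    2^n≢0 : NonZero (2 ^ n)
    2^n≢0 = ℕ.m^n≢0 2 n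

  odd-invertible-mod-2^ : ∀ {u} → u % 2 ≡ 1 → ∃[ v ] v % 2 ≡ 1 × v * u % 2 ^ n ≡ 1 % 2 ^ n
  odd-invertible-mod-2^ {u} u-odd with odd⇒^[2^k]≡1+t*2^[1+k] u-odd n
  ... | t , u^2^n≡1+t*2^[1+n] = u ^ ℕ.pred (2 ^ n) , ^-odd {u} u-odd (ℕ.pred (2 ^ n)) , (begin
    u ^ ℕ.pred (2 ^ n) * u % 2 ^ n   ≡⟨ cong (_% 2 ^ n) (ℕ.*-comm (u ^ ℕ.pred (2 ^ n)) u) ⟩
    u ^ suc (ℕ.pred (2 ^ n)) % 2 ^ n ≡⟨ cong (λ e → u ^ e % 2 ^ n) (ℕ.suc-pred (2 ^ n)) ⟩
    u ^ 2 ^ n % 2 ^ n                ≡⟨ cong (_% 2 ^ n) u^2^n≡1+t*2^[1+n] ⟩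
    (1 + t * (2 * 2 ^ n)) % 2 ^ n    ≡⟨ cong (λ e → (1 + e) % 2 ^ n) (ℕ.*-assoc t 2 (2 ^ n)) ⟨
    (1 + t * 2 * 2 ^ n) % 2 ^ n      ≡⟨ [m+kn]%n≡m%n 1 (t * 2) (2 ^ n) ⟩
    1 % 2 ^ n                        ∎)
    where open ≡-Reasoning

  inOrbit⁺ : ∀ {z} (g h : G n) → z < 2 ^ n → z % 2 ≡ 1 → z · g ≡ h → T (inOrbit n g h)
  inOrbit⁺ {z} (gx , gy) _ z<2^n z-odd refl = any⁺ _ (applyUpTo⁺ id matches z<2^n)
    where
    open Equivalence
    matches : T ((z % 2 ≡ᵇ 1) ∧ (z * toℕ gx % 2 ^ n ≡ᵇ toℕ (scale z gx)) ∧ (z * toℕ gy % 2 ^ n ≡ᵇ toℕ (scale z gy)))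
    matches = from T-∧ (ℕ.≡⇒≡ᵇ _ _ z-odd , from T-∧
      (ℕ.≡⇒≡ᵇ _ _ (sym (toℕ-scale z gx)) , ℕ.≡⇒≡ᵇ _ _ (sym (toℕ-scale z gy))))

  inOrbit⁻ : ∀ (g h : G n) → T (inOrbit n g h) → ∃[ z ] z % 2 ≡ 1 × z · g ≡ h
  inOrbit⁻ (gx , gy) (x , y) g~h with applyUpTo⁻ id {2 ^ n} (any⁻ _ _ g~h)
  ... | z , _ , matches with Equivalence.to T-∧ matches
  ... | z-odd , matches′ with Equivalence.to T-∧ matches′
  ... | zgx≡x , zgy≡y = z , ℕ.≡ᵇ⇒≡ _ _ z-odd , cong₂ _,_ (scale≡ gx x zgx≡x) (scale≡ gy y zgy≡y)
    where
    scale≡ : ∀ c x → T (z * toℕ c % 2 ^ n ≡ᵇ toℕ x) → scale z c ≡ x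
    scale≡ c x t = toℕ-injective (trans (toℕ-scale z c) (ℕ.≡ᵇ⇒≡ _ _ t))

  inOrbit-· : .{{_ : NonZero n}} → ∀ w → w % 2 ≡ 1 → (g h : G n) → T (inOrbit n g h) → T (inOrbit n g (w · h))
  inOrbit-· w w-odd g h g~h with inOrbit⁻ g h g~h
  ... | z , z-odd , zg≡h = inOrbit⁺ g (w · h) (m%n<n (w * z) (2 ^ n)) wz-odd (begin
    (w * z % 2 ^ n) · g ≡⟨ ·-cong (m%n%n≡m%n (w * z) (2 ^ n)) g ⟩
    (w * z) · g         ≡⟨ ·-* z w g ⟩
    w · z · g           ≡⟨ cong (w ·_) zg≡h ⟩
    w · h               ∎)
    where
    open ≡-Reasoning
    wz-odd : w * z % 2 ^ n % 2 ≡ 1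
    wz-odd = trans (m∣n⇒o%n%m≡o%m 2 (2 ^ n) (w * z) (2∣2^n n)) (*-odd {w} {z} w-odd z-odd)

  inOrbit-·-invariant : .{{_ : NonZero n}} → ∀ u v → u % 2 ≡ 1 → v % 2 ≡ 1 → v * u % 2 ^ n ≡ 1 % 2 ^ n →
                        (g h : G n) → inOrbit n g (u · h) ≡ inOrbit n g h
  inOrbit-·-invariant u v u-odd v-odd vu≡1 g h = T⇔T⇒≡
    (λ g~uh → subst (T ∘ inOrbit n g) (·-inverse u v vu≡1 h) (inOrbit-· v v-odd g (u · h) g~uh))
    (inOrbit-· u u-odd g h)

  zpow-cong : ∀ {e e'} → e % 2 ^ n ≡ e' % 2 ^ n → ∀ i → zpow n e i ≡ zpow n e' i
  zpow-cong e≡e' i rewrite e≡e' = refl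

  char-· : ∀ u (χ h : G n) i → char n χ (u · h) i ≡ char n (u · χ) h i
  char-· u (a , b) (x , y) i = zpow-cong (begin
    (toℕ a * toℕ (scale u x) + toℕ b * toℕ (scale u y)) % N
      ≡⟨ cong₂ (λ p q → (toℕ a * p + toℕ b * q) % N) (toℕ-scale u x) (toℕ-scale u y) ⟩
    (toℕ a * (u * toℕ x % N) + toℕ b * (u * toℕ y % N)) % N
      ≡⟨ [a*[u*x%d]+b*[u*y%d]]%d≡[u*[a*x+b*y]]%d (toℕ a) (toℕ b) u (toℕ x) (toℕ y) N ⟩
    u * (toℕ a * toℕ x + toℕ b * toℕ y) % N
      ≡⟨ cong (λ e → u * e % N) (cong₂ _+_ (ℕ.*-comm (toℕ a) (toℕ x)) (ℕ.*-comm (toℕ b) (toℕ y))) ⟩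
    u * (toℕ x * toℕ a + toℕ y * toℕ b) % N
      ≡⟨ [a*[u*x%d]+b*[u*y%d]]%d≡[u*[a*x+b*y]]%d (toℕ x) (toℕ y) u (toℕ a) (toℕ b) N ⟨
    (toℕ x * (u * toℕ a % N) + toℕ y * (u * toℕ b % N)) % N
      ≡⟨ cong₂ (λ p q → (p + q) % N) (ℕ.*-comm (toℕ x) _) (ℕ.*-comm (toℕ y) _) ⟩
    ((u * toℕ a % N) * toℕ x + (u * toℕ b % N) * toℕ y) % N
      ≡⟨ cong₂ (λ p q → (p * toℕ x + q * toℕ y) % N) (toℕ-scale u a) (toℕ-scale u b) ⟨
    (toℕ (scale u a) * toℕ x + toℕ (scale u b) * toℕ y) % N ∎) i
    where
    N = 2 ^ n
    open ≡-Reasoning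

  IsPower⇒≡· : ∀ {χ₁ χ₂ m} → IsPower n χ₁ χ₂ m → χ₂ ≡ (m %ℕ 2 ^ n) · χ₁
  IsPower⇒≡· {a , b} {c , d} {m} (c≡ , d≡) = cong₂ _,_ (coordinate a c≡) (coordinate b d≡)
    where
    coordinate : ∀ {c} (a : Fin (2 ^ n)) → toℕ c ≡ (m ℤ.* + toℕ a) zmod2^ n → c ≡ scale (m %ℕ 2 ^ n) a
    coordinate {c} a c≡ = toℕ-injective (begin
      toℕ c                        ≡⟨ c≡ ⟩
      (m ℤ.* + toℕ a) %ℕ 2 ^ n     ≡⟨ [i*a]%ℕd≡[i%ℕd*a]%d m (toℕ a) (2 ^ n) ⟩
      m %ℕ 2 ^ n * toℕ a % 2 ^ n   ≡⟨ toℕ-scale (m %ℕ 2 ^ n) a ⟨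
      toℕ (scale (m %ℕ 2 ^ n) a)   ∎)
      where open ≡-Reasoning

  charSum-∑² : ∀ (χ : G n → Cyc n) M i →
               charSum n χ M i ≡ ∑[ x < 2 ^ n ] ∑[ y < 2 ^ n ] (if M (x , y) then χ (x , y) else czero n) i
  charSum-∑² χ M i = trans (foldr-cadd n (λ h → if M h then χ h else czero n) (elements n) i)
    (∑ᴸ-allFin² (λ h → (if M h then χ h else czero n) i))

  charSum-permute : ∀ (π : Permutation′ (2 ^ n)) (χ₁ χ₂ : G n → Cyc n) M i →
                    (∀ x y → M (π ⟨$⟩ʳ x , π ⟨$⟩ʳ y) ≡ M (x , y)) →
                    (∀ x y → χ₁ (π ⟨$⟩ʳ x , π ⟨$⟩ʳ y) i ≡ χ₂ (x , y) i) →
                    charSum n χ₁ M i ≡ charSum n χ₂ M i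
  charSum-permute π χ₁ χ₂ M i M-invariant χ₁π≡χ₂ = begin
    charSum n χ₁ M i                                            ≡⟨ charSum-∑² χ₁ M i ⟩
    ∑[ x < 2 ^ n ] ∑[ y < 2 ^ n ] term χ₁ (x , y)               ≡⟨ ∑²-permute (term χ₁) π ⟩
    ∑[ x < 2 ^ n ] ∑[ y < 2 ^ n ] term χ₁ (π ⟨$⟩ʳ x , π ⟨$⟩ʳ y) ≡⟨ sum-cong-≗ (λ x → sum-cong-≗ (termwise x)) ⟩
    ∑[ x < 2 ^ n ] ∑[ y < 2 ^ n ] term χ₂ (x , y)               ≡⟨ charSum-∑² χ₂ M i ⟨
    charSum n χ₂ M i                                            ∎
    where
    open ≡-Reasoning
    term : (G n → Cyc n) → G n → ℤ
    term χ h = (if M h then χ h else czero n) i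
    termwise : ∀ x y → term χ₁ (π ⟨$⟩ʳ x , π ⟨$⟩ʳ y) ≡ term χ₂ (x , y)
    termwise x y rewrite M-invariant x y with M (x , y)
    ... | true  = χ₁π≡χ₂ x y
    ... | false = refl

  charSum-odd-· : .{{_ : NonZero n}} → ∀ u → u % 2 ≡ 1 → (χ g : G n) → ∀ i →
                  charSum n (char n χ) (Node n g) i ≡ charSum n (char n (u · χ)) (Node n g) i
  charSum-odd-· u u-odd χ g i with odd-invertible-mod-2^ u-odd
  ... | v , v-odd , vu≡1 = charSum-permute (scale-permutation u v vu≡1) (char n χ) (char n (u · χ)) (Node n g) i
    (λ x y → inOrbit-·-invariant u v u-odd v-odd vu≡1 g (x , y))
    (λ x y → char-· u χ (x , y) i)

lemma2p3 : (n : ℕ) → 2 ≤ n → (χ₁ χ₂ : G n) →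
    Σ ℤ (λ m → OddInt m × IsPower n χ₁ χ₂ m) →
    (g : G n) → ∀ i → charSum n (char n χ₁) (Node n g) i ≡ charSum n (char n χ₂) (Node n g) i
lemma2p3 n (s≤s (s≤s _)) χ₁ χ₂ (m , m-odd , χ₂≡χ₁^m) g i = begin
  charSum n (char n χ₁) (Node n g) i       ≡⟨ charSum-odd-· n u (%ℕ-odd (2∣2^n n) m m-odd) χ₁ g i ⟩
  charSum n (char n (u · χ₁)) (Node n g) i ≡⟨ cong (λ χ → charSum n (char n χ) (Node n g) i)
                                                  (IsPower⇒≡· n {χ₁} {χ₂} {m} χ₂≡χ₁^m) ⟨
  charSum n (char n χ₂) (Node n g) i       ∎
  where
  open ≡-Reasoning
  instance
    2^n≢0 : NonZero (2 ^ n)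
    2^n≢0 = ℕ.m^n≢0 2 n
  u = m %ℕ 2 ^ n
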